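{- Let $G$ be a finite graph that is both chordal and a C-I graph, and let $v$ be a simplicial vertex of $G$. If $G$ has exactly two independent simplicial vertices, then either $G\setminus v$ is a chordal C-I graph with exactly two independent simplicial vertices, or $G\setminus v$ is a complete graph.
   Context: A graph is chordal if it has no induced cycle of length greater than $3$. A vertex is simplicial if its neighbourhood induces a complete subgraph. "$G$ has exactly two independent simplicial vertices" means that the maximum cardinality of a set of pairwise non-adjacent simplicial vertices of $G$ is $2$. For a finite poset $P=(V,\le)$, write $u\lhd v$ if $u<v$ and no $w$ satisfies $u<w<v$, and $u\,\|\,v$ if $u,v$ are incomparable. The C-I graph $G_P$ of $P$ has vertex set $V$ with $uv$ an edge iff $u\lhd v$, $v\lhd u$, or $u\,\|\,v$. A graph is a C-I graph if it is isomorphic to $G_P$ for some finite poset $P$. -}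

module Defs where

open import Data.Nat using (ℕ; zero; suc; _≤_; _<_)
open import Data.Fin using (Fin; toℕ; punchIn)
open import Data.Bool using (Bool; true; false)
open import Data.Product using (Σ; _×_; _,_; ∃)
open import Data.Sum using (_⊎_)
open import Relation.Binary.PropositionalEquality using (_≡_; _≢_)
open import Relation.Binary.Structures using (IsPartialOrder)
open import Relation.Nullary using (¬_)
open import Function.Definitions using (Injective)
open import Function.Bundles using (_⤖_; Bijection)
open import Data.Empty using (⊥)

record Graph (n : ℕ) : Set where
  field
    adj     : Fin n → Fin n → Bool
    sym     : ∀ u w → adj u w ≡ adj w u
    irrefl  : ∀ u → adj u u ≡ false
open Graph public

Adj : ∀ {n} → Graph n → Fin n → Fin n → Set
Adj G u w = adj G u w ≡ true

CycNext : ∀ {k} → Fin k → Fin k → Set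
CycNext {k} i j = (suc (toℕ i) ≡ toℕ j) ⊎ ((suc (toℕ i) ≡ k) × (toℕ j ≡ 0))

CycAdj : ∀ {k} → Fin k → Fin k → Set
CycAdj i j = CycNext i j ⊎ CycNext j i

record InducedCycle {n : ℕ} (G : Graph n) (k : ℕ) : Set where
  field
    c      : Fin k → Fin n
    inj    : Injective _≡_ _≡_ c
    edges  : ∀ i j → CycAdj i j → Adj G (c i) (c j)
    nonedg : ∀ i j → i ≢ j → ¬ CycAdj i j → ¬ Adj G (c i) (c j)

Chordal : ∀ {n} → Graph n → Set
Chordal G = ∀ k → 3 < k → ¬ InducedCycle G k

Simplicial : ∀ {n} → Graph n → Fin n → Set
Simplicial G v = ∀ u w → Adj G v u → Adj G v w → u ≢ w → Adj G u w

IndepSimplicialSet : ∀ {n} → Graph n → (m : ℕ) → (Fin m → Fin n) → Set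
IndepSimplicialSet G m f =
  Injective _≡_ _≡_ f × (∀ i → Simplicial G (f i)) × (∀ i j → ¬ Adj G (f i) (f j))

MaxIndepSimplicial : ∀ {n} → Graph n → ℕ → Set
MaxIndepSimplicial G k =
  (Σ (Fin k → Fin _) λ f → IndepSimplicialSet G k f)
  × (∀ m (f : Fin m → Fin _) → IndepSimplicialSet G m f → m ≤ k)

Complete : ∀ {n} → Graph n → Set
Complete G = ∀ u w → u ≢ w → Adj G u w

module _ {m : ℕ} (_≼_ : Fin m → Fin m → Set) where
  _≺_ : Fin m → Fin m → Set
  u ≺ v = (u ≼ v) × (u ≢ v)

  _⊲_ : Fin m → Fin m → Set
  u ⊲ v = (u ≺ v) × (¬ Σ (Fin m) λ w → (u ≺ w) × (w ≺ v))

  _∥_ : Fin m → Fin m → Set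
  u ∥ v = ¬ (u ≼ v) × ¬ (v ≼ u)

  CIEdge : Fin m → Fin m → Set
  CIEdge u v = (u ⊲ v) ⊎ (v ⊲ u) ⊎ (u ∥ v)

IsCIGraph : ∀ {n} → Graph n → Set₁
IsCIGraph {n} G =
  Σ ℕ λ m → Σ (Fin m → Fin m → Set) λ _≼_ → IsPartialOrder _≡_ _≼_ ×
    Σ (Fin n ⤖ Fin m) λ σ →
      ∀ u w → (Adj G u w → CIEdge _≼_ (Bijection.to σ u) (Bijection.to σ w))
            × (CIEdge _≼_ (Bijection.to σ u) (Bijection.to σ w) → Adj G u w)

deleteVertex : ∀ {n} → Graph (suc n) → Fin (suc n) → Graph n
deleteVertex G v = record
  { adj    = λ i j → adj G (punchIn v i) (punchIn v j)
  ; sym    = λ i j → sym G (punchIn v i) (punchIn v j)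
  ; irrefl = λ i → irrefl G (punchIn v i)
  }

{-# OPTIONS --safe #-}
module Submission where

-- Deleting any vertex keeps a graph chordal. Deleting a simplicial vertex v of a C-I graph G_P
-- gives the C-I graph of P − v: no cover relation of P − v skips over v, because in a C-I graph
-- a simplicial vertex is never strictly between two elements. For the same reason three pairwise
-- non-adjacent, hence pairwise comparable, simplicial vertices cannot exist, so a C-I graph has at
-- most two independent simplicial vertices. Finally, by Dirac's lemma a chordal graph that is not
-- complete has two independent simplicial vertices; so G − v is complete or has exactly two.

open import Defs hiding (sym; _≺_; _⊲_)
import Defs
open import Data.Bool using (true)
open import Data.Bool.Properties using () renaming (_≟_ to _≟ᵇ_)
open import Data.Empty using (⊥; ⊥-elim)
open import Data.Fin as Fin using (Fin; toℕ; punchIn; punchOut)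
open import Data.Fin.Induction using (po-wellFounded; po-noetherian)
open import Data.Fin.Properties
  using (any?; all?; punchIn-injective; punchIn-punchOut; toℕ-injective; toℕ<n)
  renaming (_≟_ to _≟ᶠ_)
open import Data.List using (List; length; filter; allFin)
open import Data.List.Membership.Propositional using (_∈_)
open import Data.List.Membership.Propositional.Properties using (∈-filter⁺; ∈-allFin)
open import Data.List.Properties using (filter-notAll)
import Data.List.Relation.Unary.Any as Any
open import Data.Nat using (ℕ; zero; suc; _+_; _≤_; _<_; z≤n; s≤s; z<s)
open import Data.Nat.Induction using (<-wellFounded)
open import Data.Nat.Properties
  using (≤-refl; ≤-trans; <⇒≤; ≤-pred; ≤⇒≯; <-trans; ≤-<-trans; <-≤-trans; <-cmp; m≤m+n;
         m<n⇒m<1+n; m≤n⇒m≤1+n; m≤n⇒m<n∨m≡n; m≤n⇒∃[o]m+o≡n; ≤∧≢⇒<; +-monoˡ-≤; suc-injective;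
         _≤?_)
open import Data.Nat.Tactic.RingSolver using (solve-∀)
open import Data.Product using (Σ; ∃₂; ∃-syntax; _×_; _,_; proj₁; proj₂)
open import Data.Sum using (_⊎_; inj₁; inj₂)
open import Data.Unit using (tt)
open import Function using (_∘_; _on_)
open import Function.Bundles using (_⤖_; Bijection)
open import Function.Construct.Identity using (⤖-id)
open import Function.Definitions using (Injective)
open import Induction.WellFounded using (Acc; acc)
open import Level using (0ℓ)
open import Relation.Binary.Core using (Rel)
open import Relation.Binary.Definitions using (Transitive; Asymmetric; Symmetric; tri<; tri≈; tri>)
import Relation.Binary.Construct.NonStrictToStrict as ToStrict
import Relation.Binary.Construct.On as On
open import Relation.Binary.Construct.Closure.ReflexiveTransitive
  using (Star; ε; _◅_; _◅◅_; reverse) renaming (map to Star-map)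
open import Relation.Binary.PropositionalEquality
  using (_≡_; _≢_; refl; sym; trans; cong; subst; subst₂; isEquivalence)
open import Relation.Binary.Structures using (IsPartialOrder)
open import Relation.Nullary using (¬_; Dec; yes; no; contradiction)
open import Relation.Nullary.Decidable using (¬?; _×-dec_; _→-dec_; decidable-stable)
open import Relation.Unary using (U)

module _ {n : ℕ} (G : Graph n) where

  Adj-sym : ∀ {u w} → Adj G u w → Adj G w u
  Adj-sym {u} {w} u~w = trans (Graph.sym G w u) u~w

  Adj⇒≢ : ∀ {u w} → Adj G u w → u ≢ w
  Adj⇒≢ {u} u~u refl with trans (sym (irrefl G u)) u~u
  ... | ()

  Adj? : ∀ u w → Dec (Adj G u w)
  Adj? u w = adj G u w ≟ᵇ true

  Independent : Rel (Fin n) 0ℓ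
  Independent u w = u ≢ w × ¬ Adj G u w

  Simplicial? : ∀ v → Dec (Simplicial G v)
  Simplicial? v = all? λ u → all? λ w →
    Adj? v u →-dec Adj? v w →-dec ¬? (u ≟ᶠ w) →-dec Adj? u w

  Complete? : Dec (Complete G)
  Complete? = all? λ u → all? λ w → ¬? (u ≟ᶠ w) →-dec Adj? u w

deleteVertex-chordal : ∀ {n} (G : Graph (suc n)) v → Chordal G → Chordal (deleteVertex G v)
deleteVertex-chordal G v chordal k 3<k cycle = chordal k 3<k record
  { c      = punchIn v ∘ c
  ; inj    = inj ∘ punchIn-injective v _ _
  ; edges  = edges
  ; nonedg = nonedg
  }
  where open InducedCycle cycle

-- Posets and C-I graphs

module Order {m : ℕ} {_≼_ : Rel (Fin m) 0ℓ} (po : IsPartialOrder _≡_ _≼_) where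

  open IsPartialOrder po using (antisym)

  infix 4 _≺_ _⊲_

  _≺_ : Rel (Fin m) 0ℓ
  _≺_ = Defs._≺_ _≼_

  _⊲_ : Rel (Fin m) 0ℓ
  _⊲_ = Defs._⊲_ _≼_

  ≺-irrefl : ∀ {a} → ¬ a ≺ a
  ≺-irrefl (_ , a≢a) = a≢a refl

  ≺-trans : Transitive _≺_
  ≺-trans = ToStrict.<-trans _≡_ _≼_ po

  ≺-asym : Asymmetric _≺_
  ≺-asym = ToStrict.<-asym _≡_ _≼_ antisym

  -- _≼_ need not be decidable, so a cover can only be found up to double negation.
  ¬¬-upperCover : ∀ {a b} → a ≺ b → ¬ ¬ (∃[ c ] a ⊲ c)
  ¬¬-upperCover {a} {b} a≺b noCover = descend (po-wellFounded po b) a≺b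
    where
    descend : ∀ {c} → Acc _≺_ c → a ≺ c → ⊥
    descend (acc below) a≺c = noCover (_ , a≺c , λ (w , a≺w , w≺c) → descend (below w≺c) a≺w)

  ¬¬-lowerCover : ∀ {a b} → a ≺ b → ¬ ¬ (∃[ c ] c ⊲ b)
  ¬¬-lowerCover {a} {b} a≺b noCover = ascend (po-noetherian po a) a≺b
    where
    ascend : ∀ {c} → Acc (λ x y → y ≺ x) c → c ≺ b → ⊥
    ascend (acc above) c≺b = noCover (_ , c≺b , λ (w , c≺w , w≺b) → ascend (above c≺w) w≺b)

  ConvexImage : ∀ {n} → (Fin n → Fin m) → Set
  ConvexImage φ = ∀ {u w z} → φ u ≺ z → z ≺ φ w → ∃[ y ] φ y ≡ z

module Restriction {m n : ℕ} {_≼_ : Rel (Fin m) 0ℓ} (po : IsPartialOrder _≡_ _≼_)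
                   (φ : Fin n → Fin m) (φ-injective : Injective _≡_ _≡_ φ) where

  open Order po

  _≼φ_ : Rel (Fin n) 0ℓ
  u ≼φ w = φ u ≼ φ w

  isPartialOrder : IsPartialOrder _≡_ _≼φ_
  isPartialOrder = record
    { isPreorder = record
      { isEquivalence = isEquivalence
      ; reflexive     = λ { refl → IsPartialOrder.refl po }
      ; trans         = IsPartialOrder.trans po
      }
    ; antisym = λ u≼w w≼u → φ-injective (IsPartialOrder.antisym po u≼w w≼u)
    }

  module φ = Order isPartialOrder

  ≺-reflect : ∀ {u w} → φ u ≺ φ w → u φ.≺ w
  ≺-reflect (u≼w , φu≢φw) = u≼w , φu≢φw ∘ cong φ

  ≺-preserve : ∀ {u w} → u φ.≺ w → φ u ≺ φ w
  ≺-preserve (u≼w , u≢w) = u≼w , u≢w ∘ φ-injective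

  ⊲-reflect : ∀ {u w} → φ u ⊲ φ w → u φ.⊲ w
  ⊲-reflect (u≺w , noneBetween) =
    ≺-reflect u≺w , λ (y , u≺y , y≺w) → noneBetween (φ y , ≺-preserve u≺y , ≺-preserve y≺w)

  ⊲-preserve : ConvexImage φ → ∀ {u w} → u φ.⊲ w → φ u ⊲ φ w
  ⊲-preserve convex {u} {w} (u≺w , noneBetween) = ≺-preserve u≺w , between
    where
    between : ¬ (∃[ z ] φ u ≺ z × z ≺ φ w)
    between (z , u≺z , z≺w) with convex u≺z z≺w
    ... | y , refl = noneBetween (y , ≺-reflect u≺z , ≺-reflect z≺w)

  CIEdge-reflect : ∀ {u w} → CIEdge _≼_ (φ u) (φ w) → CIEdge _≼φ_ u w
  CIEdge-reflect (inj₁ u⊲w)        = inj₁ (⊲-reflect u⊲w)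
  CIEdge-reflect (inj₂ (inj₁ w⊲u)) = inj₂ (inj₁ (⊲-reflect w⊲u))
  CIEdge-reflect (inj₂ (inj₂ u∥w)) = inj₂ (inj₂ u∥w)

  CIEdge-preserve : ConvexImage φ → ∀ {u w} → CIEdge _≼φ_ u w → CIEdge _≼_ (φ u) (φ w)
  CIEdge-preserve convex (inj₁ u⊲w)        = inj₁ (⊲-preserve convex u⊲w)
  CIEdge-preserve convex (inj₂ (inj₁ w⊲u)) = inj₂ (inj₁ (⊲-preserve convex w⊲u))
  CIEdge-preserve convex (inj₂ (inj₂ u∥w)) = inj₂ (inj₂ u∥w)

CIRepresentation : ∀ {n m} → Graph n → Rel (Fin m) 0ℓ → Fin n ⤖ Fin m → Set
CIRepresentation H _≼_ σ =
  ∀ u w → (Adj H u w → CIEdge _≼_ (to u) (to w)) × (CIEdge _≼_ (to u) (to w) → Adj H u w)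
  where open Bijection σ using (to)

module CIRepresented {n m : ℕ} (H : Graph n) {_≼_ : Rel (Fin m) 0ℓ}
                     (po : IsPartialOrder _≡_ _≼_) (σ : Fin n ⤖ Fin m)
                     (rep : CIRepresentation H _≼_ σ) where

  open Order po
  open Bijection σ using (to; injective; strictlySurjective)

  adjacent-comparable⇒cover : ∀ {u w} → Adj H u w → to u ≺ to w → to u ⊲ to w
  adjacent-comparable⇒cover {u} {w} u~w u≺w with proj₁ (rep u w) u~w
  ... | inj₁ u⊲w              = u⊲w
  ... | inj₂ (inj₁ (w≺u , _)) = ⊥-elim (≺-asym u≺w w≺u)
  ... | inj₂ (inj₂ (u⋠w , _)) = ⊥-elim (u⋠w (proj₁ u≺w))

  -- An upper and a lower cover of to y are both adjacent to y, hence to each other,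
  -- although they are comparable without covering each other.
  simplicial-¬between : ∀ {y a b} → Simplicial H y → a ≺ to y → to y ≺ b → ⊥
  simplicial-¬between {y} simplicial a≺y y≺b =
    ¬¬-upperCover y≺b λ (c , y⊲c) → ¬¬-lowerCover a≺y λ (d , d⊲y) →
      squeezed (strictlySurjective c) (strictlySurjective d) y⊲c d⊲y
    where
    squeezed : ∀ {c d} → ∃[ yc ] to yc ≡ c → ∃[ yd ] to yd ≡ d → to y ⊲ c → d ⊲ to y → ⊥
    squeezed (yc , refl) (yd , refl) y⊲yc yd⊲y =
      proj₂ (adjacent-comparable⇒cover yd~yc yd≺yc) (to y , proj₁ yd⊲y , proj₁ y⊲yc)
      where
      yd≺yc : to yd ≺ to yc
      yd≺yc = ≺-trans (proj₁ yd⊲y) (proj₁ y⊲yc)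
      yd~yc : Adj H yd yc
      yd~yc = simplicial yd yc (proj₂ (rep y yd) (inj₂ (inj₁ yd⊲y))) (proj₂ (rep y yc) (inj₁ y⊲yc))
        λ { refl → ≺-irrefl yd≺yc }

  independent⇒¬¬comparable : ∀ {u w} → Independent H u w → ¬ ¬ (to u ≺ to w ⊎ to w ≺ to u)
  independent⇒¬¬comparable {u} {w} (u≢w , u≁w) incomparable = u≁w (proj₂ (rep u w) (inj₂ (inj₂
    ( (λ u≼w → incomparable (inj₁ (u≼w , u≢w ∘ injective)))
    , (λ w≼u → incomparable (inj₂ (w≼u , u≢w ∘ sym ∘ injective)))))))

  ¬independentSimplicialTriple : ∀ {a b c} →
    Independent H a b → Independent H b c → Independent H a c →
    Simplicial H a → Simplicial H b → Simplicial H c → ⊥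
  ¬independentSimplicialTriple {a} {b} {c} a≁b b≁c a≁c sa sb sc =
    independent⇒¬¬comparable a≁b λ ab → independent⇒¬¬comparable b≁c λ bc →
    independent⇒¬¬comparable a≁c λ ac → middle ab bc ac
    where
    middle : to a ≺ to b ⊎ to b ≺ to a → to b ≺ to c ⊎ to c ≺ to b → to a ≺ to c ⊎ to c ≺ to a → ⊥
    middle (inj₁ a≺b) (inj₁ b≺c) _          = simplicial-¬between sb a≺b b≺c
    middle (inj₂ b≺a) (inj₂ c≺b) _          = simplicial-¬between sb c≺b b≺a
    middle (inj₁ a≺b) (inj₂ c≺b) (inj₁ a≺c) = simplicial-¬between sc a≺c c≺b
    middle (inj₁ a≺b) (inj₂ c≺b) (inj₂ c≺a) = simplicial-¬between sa c≺a a≺b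
    middle (inj₂ b≺a) (inj₁ b≺c) (inj₁ a≺c) = simplicial-¬between sa b≺a a≺c
    middle (inj₂ b≺a) (inj₁ b≺c) (inj₂ c≺a) = simplicial-¬between sc b≺c c≺a

independentSimplicial-≤2 : ∀ {n} (H : Graph n) → IsCIGraph H →
  ∀ k f → IndepSimplicialSet H k f → k ≤ 2
independentSimplicial-≤2 _ _ 0 _ _ = z≤n
independentSimplicial-≤2 _ _ 1 _ _ = s≤s z≤n
independentSimplicial-≤2 _ _ 2 _ _ = ≤-refl
independentSimplicial-≤2 H (_ , _ , po , σ , rep) (suc (suc (suc k))) f
                         (f-injective , simplicial , independent) =
  ⊥-elim (¬independentSimplicialTriple (apart 0F 1F λ ()) (apart 1F 2F λ ()) (apart 0F 2F λ ())
    (simplicial 0F) (simplicial 1F) (simplicial 2F))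
  where
  open CIRepresented H po σ rep
  0F 1F 2F : Fin (suc (suc (suc k)))
  0F = Fin.zero
  1F = Fin.suc Fin.zero
  2F = Fin.suc (Fin.suc Fin.zero)
  apart : ∀ i j → i ≢ j → Independent H (f i) (f j)
  apart i j i≢j = i≢j ∘ f-injective , independent i j

deleteVertex-isCIGraph : ∀ {n} (G : Graph (suc n)) v → IsCIGraph G → Simplicial G v →
  IsCIGraph (deleteVertex G v)
deleteVertex-isCIGraph {n} G v (_ , _ , po , σ , rep) simplicial =
  n , _≼φ_ , isPartialOrder , ⤖-id (Fin n) , λ u w →
    CIEdge-reflect ∘ proj₁ (rep (punchIn v u) (punchIn v w)) ,
    proj₂ (rep (punchIn v u) (punchIn v w)) ∘ CIEdge-preserve convex
  where
  open Bijection σ using (to; injective; strictlySurjective)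
  open CIRepresented G po σ rep using (simplicial-¬between)
  open Order po using (ConvexImage)
  open Restriction po (to ∘ punchIn v) (punchIn-injective v _ _ ∘ injective)

  convex : ConvexImage (to ∘ punchIn v)
  convex {z = z} u≺z z≺w with strictlySurjective z
  ... | y , refl with v ≟ᶠ y
  ...   | yes refl = ⊥-elim (simplicial-¬between simplicial u≺z z≺w)
  ...   | no v≢y   = punchOut v≢y , cong to (punchIn-punchOut v≢y)

-- Chordal graphs

module Chordality {n : ℕ} (G : Graph n) (chordal : Chordal G) where

  infix 4 _≁_
  _≁_ : Rel (Fin n) 0ℓ
  _≁_ = Independent G

  ≁-sym : Symmetric _≁_
  ≁-sym (u≢w , u≁w) = u≢w ∘ sym , u≁w ∘ Adj-sym G

  AvoidingStep : Fin n → Rel (Fin n) 0ℓ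
  AvoidingStep x u w = Adj G u w × x ≁ w

  module AvoidingWalks (x t : Fin n) where

    -- Only f 0, …, f k are the vertices of the walk; later values of f are irrelevant.
    record Walk (a : Fin n) (k : ℕ) (f : ℕ → Fin n) : Set where
      field
        start : f 0 ≡ a
        end   : f k ≡ t
        step  : ∀ {l} → l < k → Adj G (f l) (f (suc l))
        avoid : ∀ {l} → 0 < l → l < k → x ≁ f l
    open Walk public

    ShorterWalk : Fin n → ℕ → Set
    ShorterWalk a k = ∃₂ λ k′ f′ → k′ < k × Walk a k′ f′

    data Shortcut (k : ℕ) (f : ℕ → Fin n) : Set where
      chord  : ∀ {i j} → suc i < j → j ≤ k → Adj G (f i) (f j) → Shortcut k f
      repeat : ∀ {i j} → i < j → j ≤ k → f i ≡ f j → Shortcut k f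

    prepend : Fin n → (ℕ → Fin n) → ℕ → Fin n
    prepend a f zero    = a
    prepend a f (suc l) = f l

    prepend-walk : ∀ {a b k f} → AvoidingStep x a b → Walk b k f → Walk a (suc k) (prepend a f)
    prepend-walk {a} (a~b , x≁b) w = record
      { start = refl
      ; end   = end w
      ; step  = λ { {zero} _ → subst (Adj G a) (sym (start w)) a~b ; {suc _} (s≤s l<k) → step w l<k }
      ; avoid = λ { {suc zero} _ _ → subst (x ≁_) (sym (start w)) x≁b
                  ; {suc (suc _)} _ (s≤s l<k) → avoid w z<s l<k }
      }

    avoidingPath⇒walk : ∀ {a c} → Star (AvoidingStep x) a c → Adj G c t → ∃₂ (Walk a)
    avoidingPath⇒walk {a} ε a~t = 1 , prepend a (λ _ → t) , record
      { start = refl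
      ; end   = refl
      ; step  = λ { {zero} _ → a~t ; {suc _} (s≤s ()) }
      ; avoid = λ { {zero} () ; {suc _} _ (s≤s ()) }
      }
    avoidingPath⇒walk (step ◅ path) c~t =
      let (k , f , w) = avoidingPath⇒walk path c~t in suc k , prepend _ f , prepend-walk step w

    splice : (ℕ → Fin n) → ℕ → ℕ → ℕ → Fin n
    splice f i e l with l ≤? i
    ... | yes _ = f l
    ... | no  _ = f (suc (l + e))

    splice-≤ : ∀ f i e {l} → l ≤ i → splice f i e l ≡ f l
    splice-≤ f i e {l} l≤i with l ≤? i
    ... | yes _   = refl
    ... | no  l≰i = contradiction l≤i l≰i

    splice-> : ∀ f i e {l} → i < l → splice f i e l ≡ f (suc (l + e))
    splice-> f i e {l} i<l with l ≤? i
    ... | yes l≤i = contradiction i<l (≤⇒≯ l≤i)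
    ... | no  _   = refl

    splice-walk : ∀ {a f} i e r → Adj G (f i) (f (suc (suc i) + e)) →
                  Walk a (suc (suc i) + e + r) f → ShorterWalk a (suc (suc i) + e + r)
    splice-walk {f = f} i e r jump w =
      suc i + r , splice f i e , s≤s (s≤s (+-monoˡ-≤ r (m≤m+n i e))) , record
        { start = trans (low z≤n) (start w)
        ; end   = trans (high (s≤s (m≤m+n i r))) (trans (cong (f ∘ suc ∘ suc) (swap i r e)) (end w))
        ; step  = step′
        ; avoid = avoid′
        }
      where
      low : ∀ {l} → l ≤ i → splice f i e l ≡ f l
      low = splice-≤ f i e
      high : ∀ {l} → i < l → splice f i e l ≡ f (suc (l + e))
      high = splice-> f i e
      swap : ∀ i r e → i + r + e ≡ i + e + r
      swap = solve-∀
      skip : ∀ {l} → l < suc i + r → suc (l + e) < suc (suc i) + e + r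
      skip {l} (s≤s l≤i+r) = s≤s (s≤s (subst (l + e ≤_) (swap i r e) (+-monoˡ-≤ e l≤i+r)))
      i<k : i < suc (suc i) + e + r
      i<k = s≤s (m≤n⇒m≤1+n (≤-trans (m≤m+n i e) (m≤m+n (i + e) r)))
      step′ : ∀ {l} → l < suc i + r → Adj G (splice f i e l) (splice f i e (suc l))
      step′ {l} l< with <-cmp l i
      ... | tri< l<i _ _  = subst₂ (Adj G) (sym (low (<⇒≤ l<i))) (sym (low l<i))
                              (step w (<-trans l<i i<k))
      ... | tri≈ _ refl _ = subst₂ (Adj G) (sym (low ≤-refl)) (sym (high ≤-refl)) jump
      ... | tri> _ _ i<l  = subst₂ (Adj G) (sym (high i<l)) (sym (high (m<n⇒m<1+n i<l)))
                              (step w (skip l<))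
      avoid′ : ∀ {l} → 0 < l → l < suc i + r → x ≁ splice f i e l
      avoid′ {l} 0<l l< with l ≤? i
      ... | yes l≤i = avoid w 0<l (≤-<-trans l≤i i<k)
      ... | no  _   = avoid w z<s (skip l<)

    truncate-walk : ∀ {a k f i} → i ≤ k → f i ≡ t → Walk a k f → Walk a i f
    truncate-walk i≤k fi≡t w = record
      { start = start w
      ; end   = fi≡t
      ; step  = λ l<i → step w (<-≤-trans l<i i≤k)
      ; avoid = λ 0<l l<i → avoid w 0<l (<-≤-trans l<i i≤k)
      }

    shorten : ∀ {a k f} → Walk a k f → Shortcut k f → ShorterWalk a k
    shorten w (chord {i} i+1<j j≤k fi~fj) with m≤n⇒∃[o]m+o≡n i+1<j | m≤n⇒∃[o]m+o≡n j≤k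
    ... | e , refl | r , refl = splice-walk i e r fi~fj w
    shorten {f = f} w (repeat {i} i<j j≤k fi≡fj) with m≤n⇒m<n∨m≡n j≤k
    ... | inj₂ refl = _ , _ , i<j , truncate-walk (<⇒≤ i<j) (trans fi≡fj (end w)) w
    ... | inj₁ j<k with m≤n⇒∃[o]m+o≡n i<j | m≤n⇒∃[o]m+o≡n j<k
    ...   | e , refl | r , refl =
      splice-walk i e r (subst (λ y → Adj G y (f (suc (suc i) + e))) (sym fi≡fj) (step w j<k)) w

  module _ {x s t : Fin n} (x~s : Adj G x s) (x~t : Adj G x t) (s≁t : s ≁ t) where

    open AvoidingWalks x t

    walk-length≥2 : ∀ {k f} → Walk s k f → 2 ≤ k
    walk-length≥2 {0}           w = ⊥-elim (proj₁ s≁t (trans (sym (start w)) (end w)))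
    walk-length≥2 {1}           w = ⊥-elim (proj₂ s≁t (subst₂ (Adj G) (start w) (end w) (step w z<s)))
    walk-length≥2 {suc (suc _)} _ = s≤s (s≤s z≤n)

    module _ {k f} (w : Walk s k f) (noShortcut : ¬ Shortcut k f) where

      cycle : ℕ → Fin n
      cycle = prepend x f

      x≢walk : ∀ {l} → l ≤ k → x ≢ f l
      x≢walk {zero}  _      = subst (x ≢_) (sym (start w)) (Adj⇒≢ G x~s)
      x≢walk {suc l} l+1≤k with m≤n⇒m<n∨m≡n l+1≤k
      ... | inj₁ l+1<k = proj₁ (avoid w z<s l+1<k)
      ... | inj₂ refl  = subst (x ≢_) (sym (end w)) (Adj⇒≢ G x~t)

      cycle-injective : ∀ {a b} → a < suc (suc k) → b < suc (suc k) → cycle a ≡ cycle b → a ≡ b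
      cycle-injective {zero}  {zero}  _  _  _     = refl
      cycle-injective {zero}  {suc _} _  b< x≡fb  = ⊥-elim (x≢walk (≤-pred (≤-pred b<)) x≡fb)
      cycle-injective {suc _} {zero}  a< _  fa≡x  = ⊥-elim (x≢walk (≤-pred (≤-pred a<)) (sym fa≡x))
      cycle-injective {suc a} {suc b} a< b< fa≡fb with <-cmp a b
      ... | tri< a<b _ _ = ⊥-elim (noShortcut (repeat a<b (≤-pred (≤-pred b<)) fa≡fb))
      ... | tri≈ _ a≡b _ = cong suc a≡b
      ... | tri> _ _ b<a = ⊥-elim (noShortcut (repeat b<a (≤-pred (≤-pred a<)) (sym fa≡fb)))

      cycle-next : ∀ {a b} → b < suc (suc k) → suc a ≡ b → Adj G (cycle a) (cycle b)
      cycle-next {zero}  _  refl = subst (Adj G x) (sym (start w)) x~s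
      cycle-next {suc _} b< refl = step w (≤-pred (≤-pred b<))

      cycle-wrap : Adj G (cycle (suc k)) (cycle 0)
      cycle-wrap = subst (λ y → Adj G y x) (sym (end w)) (Adj-sym G x~t)

      cycle-nonadjacent : ∀ {a b} → a < b → b < suc (suc k) →
        suc a ≢ b → ¬ (suc b ≡ suc (suc k) × a ≡ 0) → ¬ Adj G (cycle a) (cycle b)
      cycle-nonadjacent {zero} {suc zero} _ _ 1≢1 _ = ⊥-elim (1≢1 refl)
      cycle-nonadjacent {zero} {suc (suc b)} _ b< _ ¬wrap =
        proj₂ (avoid w z<s (≤∧≢⇒< (≤-pred (≤-pred b<)) λ { refl → ¬wrap (refl , refl) }))
      cycle-nonadjacent {suc a} {suc b} a<b b< a+1≢b _ fa~fb =
        noShortcut (chord (≤∧≢⇒< (≤-pred a<b) (a+1≢b ∘ cong suc)) (≤-pred (≤-pred b<)) fa~fb)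

      inducedCycle : InducedCycle G (suc (suc k))
      inducedCycle = record
        { c      = cycle ∘ toℕ
        ; inj    = λ {i} {j} → toℕ-injective ∘ cycle-injective (toℕ<n i) (toℕ<n j)
        ; edges  = λ { i j (inj₁ i→j) → next-edge i→j ; i j (inj₂ j→i) → Adj-sym G (next-edge j→i) }
        ; nonedg = nonedge
        }
        where
        next-edge : ∀ {i j} → CycNext i j → Adj G (cycle (toℕ i)) (cycle (toℕ j))
        next-edge {j = j} (inj₁ i+1≡j) = cycle-next (toℕ<n j) i+1≡j
        next-edge (inj₂ (i+1≡K , j≡0)) =
          subst₂ (λ p q → Adj G (cycle p) (cycle q)) (sym (suc-injective i+1≡K)) (sym j≡0) cycle-wrap
        nonedge : ∀ i j → i ≢ j → ¬ CycAdj i j → ¬ Adj G (cycle (toℕ i)) (cycle (toℕ j))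
        nonedge i j i≢j ¬i~j with <-cmp (toℕ i) (toℕ j)
        ... | tri< i<j _ _ = cycle-nonadjacent i<j (toℕ<n j) (¬i~j ∘ inj₁ ∘ inj₁) (¬i~j ∘ inj₂ ∘ inj₂)
        ... | tri≈ _ i≡j _ = ⊥-elim (i≢j (toℕ-injective i≡j))
        ... | tri> _ _ j<i =
          cycle-nonadjacent j<i (toℕ<n i) (¬i~j ∘ inj₂ ∘ inj₁) (¬i~j ∘ inj₁ ∘ inj₂) ∘ Adj-sym G

    -- A shortest walk has no shortcut, so it closes up with x into a chordless cycle.
    noWalk : ∀ {k} → Acc _<_ k → ∀ {f} → ¬ Walk s k f
    noWalk (acc shorter) w = chordal _ (s≤s (s≤s (walk-length≥2 w))) (inducedCycle w λ cut →
      let (_ , _ , k′<k , w′) = shorten w cut in noWalk (shorter k′<k) w′)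

  avoidingPath⇒adjacent : ∀ {x s t c} → Adj G x s → Adj G x t → s ≢ t →
    Star (AvoidingStep x) s c → Adj G c t → Adj G s t
  avoidingPath⇒adjacent {x} {s} {t} x~s x~t s≢t path c~t = decidable-stable (Adj? G s t) λ s≁t →
    let (_ , _ , w) = AvoidingWalks.avoidingPath⇒walk x t path c~t in
    noWalk x~s x~t (s≢t , s≁t) (<-wellFounded _) w

  SimplicialIn : (Fin n → Set) → Fin n → Set
  SimplicialIn X s = ∀ u w → X u → X w → Adj G s u → Adj G s w → u ≢ w → Adj G u w

  IndependentSimplicialPairIn : (Fin n → Set) → Set
  IndependentSimplicialPairIn X =
    ∃₂ λ s₁ s₂ → X s₁ × X s₂ × s₁ ≁ s₂ × SimplicialIn X s₁ × SimplicialIn X s₂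

  HasSimplicialApart : (Fin n → Set) → Set
  HasSimplicialApart X = ∀ {x z} → X x → X z → x ≁ z → ¬ ¬ (∃[ s ] X s × x ≁ s × SimplicialIn X s)

  ¬¬-independentSimplicialPair : ∀ {X} → HasSimplicialApart X →
    ∀ {u w} → X u → X w → u ≁ w → ¬ ¬ IndependentSimplicialPairIn X
  ¬¬-independentSimplicialPair apart Xu Xw u≁w found =
    apart Xu Xw u≁w λ (s₁ , Xs₁ , u≁s₁ , simplicial₁) →
    apart Xs₁ Xu (≁-sym u≁s₁) λ (s₂ , Xs₂ , s₁≁s₂ , simplicial₂) →
    found (s₁ , s₂ , Xs₁ , Xs₂ , s₁≁s₂ , simplicial₁ , simplicial₂)

  -- Dirac's argument: Component is the component of z in X − N[x] and Boundary the set of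
  -- neighbours of x adjacent to it. Boundary is a clique by avoidingPath⇒adjacent, and
  -- Y = Component ∪ Boundary contains all X-neighbours of Component but not x.
  module Separation {X : Fin n → Set} {x z : Fin n} (Xz : X z) (x≁z : x ≁ z) where

    Outside : Fin n → Set
    Outside v = X v × x ≁ v

    Link : Rel (Fin n) 0ℓ
    Link u w = Outside u × Outside w × Adj G u w

    Component : Fin n → Set
    Component = Star Link z

    Boundary : Fin n → Set
    Boundary v = X v × Adj G x v × ∃[ c ] Component c × Adj G c v

    Y : Fin n → Set
    Y v = Component v ⊎ Boundary v

    outside-end : ∀ {a b} → Outside a → Star Link a b → Outside b
    outside-end outside ε                          = outside
    outside-end _       ((_ , outside , _) ◅ path) = outside-end outside path

    component-outside : ∀ {v} → Component v → Outside v
    component-outside = outside-end (Xz , x≁z)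

    Y-neighbour : ∀ {c v} → Component c → X v → Adj G c v → Y v
    Y-neighbour {c} {v} zc Xv c~v with Adj? G x v
    ... | yes x~v = inj₂ (Xv , x~v , c , zc , c~v)
    ... | no  x≁v = inj₁ (zc ◅◅ (component-outside zc , (Xv , x≢v , x≁v) , c~v) ◅ ε)
      where
      x≢v : x ≢ v
      x≢v refl = proj₂ (proj₂ (component-outside zc)) (Adj-sym G c~v)

    boundary-clique : ∀ {s t} → Boundary s → Boundary t → s ≢ t → Adj G s t
    boundary-clique {s} (_ , x~s , cs , zcs , cs~s) (_ , x~t , _ , zct , ct~t) s≢t =
      avoidingPath⇒adjacent x~s x~t s≢t (s→cs ◅ Star-map avoiding (reverse Link-sym zcs ◅◅ zct)) ct~t
      where
      s→cs : AvoidingStep x s cs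
      s→cs = Adj-sym G cs~s , proj₂ (component-outside zcs)
      Link-sym : Symmetric Link
      Link-sym (outside-u , outside-w , u~w) = outside-w , outside-u , Adj-sym G u~w
      avoiding : ∀ {u w} → Link u w → AvoidingStep x u w
      avoiding (_ , (_ , x≁w) , u~w) = u~w , x≁w

    Y-missing-x : ∀ {v} → Y v → X v × v ≢ x
    Y-missing-x (inj₁ zv)             = let (Xv , x≢v , _) = component-outside zv in Xv , x≢v ∘ sym
    Y-missing-x (inj₂ (Xv , x~v , _)) = Xv , Adj⇒≢ G x~v ∘ sym

    component-simplicial : ∀ {s} → Component s → SimplicialIn Y s → SimplicialIn X s
    component-simplicial zs simplicial u w Xu Xw s~u s~w =
      simplicial u w (Y-neighbour zs Xu s~u) (Y-neighbour zs Xw s~w) s~u s~w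

    pair-component : IndependentSimplicialPairIn Y → ∃[ s ] Component s × SimplicialIn Y s
    pair-component (s₁ , _ , inj₁ zs₁ , _ , _ , simplicial₁ , _) = s₁ , zs₁ , simplicial₁
    pair-component (_ , s₂ , inj₂ _ , inj₁ zs₂ , _ , _ , simplicial₂) = s₂ , zs₂ , simplicial₂
    pair-component (_ , _ , inj₂ b₁ , inj₂ b₂ , (s₁≢s₂ , s₁≁s₂) , _) =
      ⊥-elim (s₁≁s₂ (boundary-clique b₁ b₂ s₁≢s₂))

    -- z is simplicial in Y unless Y has an independent pair, hence an independent simplicial pair.
    ¬¬-componentSimplicial : HasSimplicialApart Y → ¬ ¬ (∃[ s ] Component s × SimplicialIn Y s)
    ¬¬-componentSimplicial apart found = found (z , ε , λ u w Yu Yw _ _ u≢w →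
      decidable-stable (Adj? G u w) λ u≁w →
        ¬¬-independentSimplicialPair apart Yu Yw (u≢w , u≁w) (found ∘ pair-component))

  hasSimplicialApart : ∀ {L} → Acc (_<_ on length) L → ∀ {X} → (∀ {v} → X v → v ∈ L) →
    HasSimplicialApart X
  hasSimplicialApart {L} (acc smaller) {X} X⊆L {x} Xx Xz x≁z found =
    ¬¬-componentSimplicial (hasSimplicialApart (smaller L′<L) Y⊆L′) λ (s , zs , simplicial) →
      let (Xs , x≁s) = component-outside zs in found (s , Xs , x≁s , component-simplicial zs simplicial)
    where
    open Separation {X} Xz x≁z

    L′ : List (Fin n)
    L′ = filter (¬? ∘ (_≟ᶠ x)) L

    Y⊆L′ : ∀ {v} → Y v → v ∈ L′
    Y⊆L′ yv = let (Xv , v≢x) = Y-missing-x yv in ∈-filter⁺ (¬? ∘ (_≟ᶠ x)) (X⊆L Xv) v≢x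

    L′<L : length L′ < length L
    L′<L = filter-notAll (¬? ∘ (_≟ᶠ x)) L (Any.map (λ x≡v v≢x → v≢x (sym x≡v)) (X⊆L Xx))

module _ {n : ℕ} (G : Graph n) where

  IndependentSimplicialPair : Set
  IndependentSimplicialPair = ∃₂ λ s₁ s₂ → Independent G s₁ s₂ × Simplicial G s₁ × Simplicial G s₂

  independentSimplicialPair? : Dec IndependentSimplicialPair
  independentSimplicialPair? = any? λ s₁ → any? λ s₂ →
    (¬? (s₁ ≟ᶠ s₂) ×-dec ¬? (Adj? G s₁ s₂)) ×-dec Simplicial? G s₁ ×-dec Simplicial? G s₂

  independentSimplicialPair⇒set : IndependentSimplicialPair → Σ (Fin 2 → Fin n) (IndepSimplicialSet G 2)
  independentSimplicialPair⇒set (s₁ , s₂ , (s₁≢s₂ , s₁≁s₂) , simplicial₁ , simplicial₂) =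
    pick , injective , simplicial , independent
    where
    pick : Fin 2 → Fin n
    pick Fin.zero    = s₁
    pick (Fin.suc _) = s₂
    injective : Injective _≡_ _≡_ pick
    injective {Fin.zero}          {Fin.zero}          _ = refl
    injective {Fin.zero}          {Fin.suc Fin.zero}  e = ⊥-elim (s₁≢s₂ e)
    injective {Fin.suc Fin.zero}  {Fin.zero}          e = ⊥-elim (s₁≢s₂ (sym e))
    injective {Fin.suc Fin.zero}  {Fin.suc Fin.zero}  _ = refl
    simplicial : ∀ i → Simplicial G (pick i)
    simplicial Fin.zero    = simplicial₁
    simplicial (Fin.suc _) = simplicial₂
    independent : ∀ i j → ¬ Adj G (pick i) (pick j)
    independent Fin.zero           Fin.zero           s~s = Adj⇒≢ G s~s refl
    independent Fin.zero           (Fin.suc Fin.zero) = s₁≁s₂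
    independent (Fin.suc Fin.zero) Fin.zero           = s₁≁s₂ ∘ Adj-sym G
    independent (Fin.suc Fin.zero) (Fin.suc Fin.zero) s~s = Adj⇒≢ G s~s refl

chordal-¬complete⇒independentSimplicialPair : ∀ {n} (G : Graph n) → Chordal G → ¬ Complete G →
  IndependentSimplicialPair G
chordal-¬complete⇒independentSimplicialPair {n} G chordal ¬complete =
  decidable-stable (independentSimplicialPair? G) λ found →
  ¬complete λ u w u≢w → decidable-stable (Adj? G u w) λ u≁w →
  ¬¬-independentSimplicialPair everywhere tt tt (u≢w , u≁w)
    λ (s₁ , s₂ , _ , _ , s₁≁s₂ , simplicial₁ , simplicial₂) →
    found (s₁ , s₂ , s₁≁s₂ , (λ u w → simplicial₁ u w tt tt) , (λ u w → simplicial₂ u w tt tt))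
  where
  open Chordality G chordal
  everywhere : HasSimplicialApart U
  everywhere =
    hasSimplicialApart (On.wellFounded length <-wellFounded (allFin n)) (λ {v} _ → ∈-allFin v)

corollary3p3 : ∀ {n} (G : Graph (suc n)) (v : Fin (suc n)) →
    Chordal G → IsCIGraph G → Simplicial G v → MaxIndepSimplicial G 2 →
    (Chordal (deleteVertex G v) × IsCIGraph (deleteVertex G v)
    × MaxIndepSimplicial (deleteVertex G v) 2)
    ⊎ Complete (deleteVertex G v)
corollary3p3 {n} G v chordal isCI simplicial _ with Complete? (deleteVertex G v)
... | yes complete  = inj₂ complete
... | no  ¬complete = inj₁ (chordal′ , isCI′ ,
        independentSimplicialPair⇒set G′ (chordal-¬complete⇒independentSimplicialPair G′ chordal′ ¬complete)
        , independentSimplicial-≤2 G′ isCI′)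
  where
  G′ : Graph n
  G′ = deleteVertex G v
  chordal′ : Chordal G′
  chordal′ = deleteVertex-chordal G v chordal
  isCI′ : IsCIGraph G′
  isCI′ = deleteVertex-isCIGraph G v isCI simplicial
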